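{- If $G$ is a connected bipartite graph, then its empty bisector graph $\widehat{G}$ is a complete bipartite graph.
   Context: All graphs are finite, simple and undirected. The empty bisector graph $\widehat{G}$ of $G$ has vertex set $V(G)$, with distinct $u,v$ adjacent iff there is no $w\in V(G)$ with $d_G(w,u)=d_G(w,v)$. -}

module Defs where

open import Data.Nat using (ℕ; zero; suc; _≤_)
open import Data.Fin using (Fin)
open import Data.Bool using (Bool; true; false)
open import Data.Product using (Σ; ∃; _×_; _,_)
open import Relation.Binary.PropositionalEquality using (_≡_; _≢_)
open import Relation.Nullary using (¬_)

record Graph (n : ℕ) : Set where
  field
    adj     : Fin n → Fin n → Bool
    sym     : ∀ u v → adj u v ≡ adj v u
    irrefl  : ∀ u → adj u u ≡ false
open Graph public

data Walk {n : ℕ} (G : Graph n) : Fin n → Fin n → ℕ → Set where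
  here : ∀ {u} → Walk G u u zero
  step : ∀ {u v w k} → adj G u v ≡ true → Walk G v w k → Walk G u w (suc k)

Dist : {n : ℕ} → Graph n → Fin n → Fin n → ℕ → Set
Dist G u v k = Walk G u v k × (∀ m → Walk G u v m → k ≤ m)

Connected : {n : ℕ} → Graph n → Set
Connected G = ∀ u v → ∃ λ k → Walk G u v k

Bipartite : {n : ℕ} → Graph n → Set
Bipartite {n} G = Σ (Fin n → Bool) λ c → ∀ u v → adj G u v ≡ true → c u ≢ c v

EBAdj : {n : ℕ} → Graph n → Fin n → Fin n → Set
EBAdj {n} G u v = u ≢ v × ¬ (Σ (Fin n) λ w → ∃ λ k → Dist G w u k × Dist G w v k)

IsCompleteBipartite : {n : ℕ} → (Fin n → Fin n → Set) → Set
IsCompleteBipartite {n} H =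
  Σ (Fin n → Bool) λ c →
    (∀ u v → u ≢ v → (H u v → c u ≢ c v) × (c u ≢ c v → H u v))
    × (2 ≤ n → (Σ (Fin n) λ a → c a ≡ true) × (Σ (Fin n) λ b → c b ≡ false))

{-# OPTIONS --safe #-}
-- In a properly 2-coloured graph the colour at the end of a walk is the colour at its start
-- flipped once per edge. So a vertex equidistant from u and v forces u and v into the same
-- colour class; conversely, if u and v have the same colour, a shortest u–v path has even
-- length 2j, and its middle vertex is at distance j from both ends (subpaths of shortest
-- paths are shortest). Hence the colouring of G itself exhibits Ĝ as complete bipartite.
module Submission where

open import Defs hiding (sym)
open import Data.Nat using (ℕ; zero; suc; _+_; _≤_; _<_; z≤n; s≤s)
open import Data.Nat.Properties using (+-comm; +-suc; +-cancelˡ-≤; +-cancelʳ-≤; ≮⇒≥; anyUpTo?)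
open import Data.Nat.Induction using (<-rec)
open import Data.Fin using (Fin; _≟_) renaming (zero to fzero; suc to fsuc)
open import Data.Fin.Properties using (any?)
open import Data.Bool using (Bool; true; false; not; _xor_) renaming (_≟_ to _≟ᵇ_)
open import Data.Bool.Properties using (not-involutive; xor-identityʳ; ¬-not; not-distribˡ-xor; not-distribʳ-xor)
open import Data.Product using (Σ; ∃; _×_; _,_; proj₂)
open import Function.Bundles using (Equivalence; _⇔_; mk⇔)
open import Relation.Unary using (Pred; Decidable)
open import Relation.Nullary using (Dec; yes; no; map′; _×-dec_)
open import Relation.Binary.PropositionalEquality

Least : ∀ {p} → Pred ℕ p → Pred ℕ p
Least P m = P m × (∀ j → P j → m ≤ j)

least-witness : ∀ {p} {P : Pred ℕ p} → Decidable P → ∀ k → P k → ∃ (Least P)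
least-witness {P = P} P? = <-rec (λ k → P k → ∃ (Least P)) search
  where
  search : ∀ k → (∀ {m} → m < k → P m → ∃ (Least P)) → P k → ∃ (Least P)
  search k rec Pk with anyUpTo? P? k
  ... | yes (m , m<k , Pm) = rec m<k Pm
  ... | no noSmaller = k , Pk , λ j Pj → ≮⇒≥ λ j<k → noSmaller (j , j<k , Pj)

module Walks {n : ℕ} (G : Graph n) where

  adj-sym : ∀ {u v} → adj G u v ≡ true → adj G v u ≡ true
  adj-sym {u} {v} e = trans (Graph.sym G v u) e

  _++ʷ_ : ∀ {u v w i j} → Walk G u v i → Walk G v w j → Walk G u w (i + j)
  here     ++ʷ q = q
  step e p ++ʷ q = step e (p ++ʷ q)

  reverse : ∀ {u v k} → Walk G u v k → Walk G v u k
  reverse here = here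
  reverse (step {k = k} e p) = subst (Walk G _ _) (+-comm k 1) (reverse p ++ʷ step (adj-sym e) here)

  splitAt : ∀ i {j u v} → Walk G u v (i + j) → Σ (Fin n) λ w → Walk G u w i × Walk G w v j
  splitAt zero    p          = _ , here , p
  splitAt (suc i) (step e p) with splitAt i p
  ... | w , p₁ , p₂ = w , step e p₁ , p₂

  walk? : ∀ k u v → Dec (Walk G u v k)
  walk? zero u v with u ≟ v
  ... | yes refl = yes here
  ... | no u≢v   = no λ { here → u≢v refl }
  walk? (suc k) u v =
    map′ (λ { (x , e , p) → step e p }) (λ { (step e p) → _ , e , p })
         (any? λ x → (adj G u x ≟ᵇ true) ×-dec walk? k x v)

  shortest : ∀ {u v k} → Walk G u v k → ∃ (Dist G u v)
  shortest {u} {v} {k} = least-witness (λ m → walk? m u v) k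

  Dist-sym : ∀ {u v k} → Dist G u v k → Dist G v u k
  Dist-sym (p , minimal) = reverse p , λ m q → minimal m (reverse q)

  Dist-split : ∀ i {j u v} → Dist G u v (i + j) →
               Σ (Fin n) λ w → Dist G u w i × Dist G w v j
  Dist-split i {j} (p , minimal) with splitAt i p
  ... | w , p₁ , p₂ =
    w , (p₁ , λ m q → +-cancelʳ-≤ j i m (minimal (m + j) (q ++ʷ p₂)))
      , (p₂ , λ m q → +-cancelˡ-≤ i j m (minimal (i + m) (p₁ ++ʷ q)))

odd : ℕ → Bool
odd zero    = false
odd (suc k) = not (odd k)

even⇒double : ∀ k → odd k ≡ false → ∃ λ j → k ≡ j + j
even⇒double zero          _ = 0 , refl
even⇒double (suc (suc k)) e with even⇒double k (trans (sym (not-involutive (odd k))) e)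
... | j , refl = suc j , cong suc (sym (+-suc j j))

x≡x-xor-y⇒y≡false : ∀ x y → x ≡ x xor y → y ≡ false
x≡x-xor-y⇒y≡false false false _ = refl
x≡x-xor-y⇒y≡false true  false _ = refl

module Colouring {n : ℕ} (G : Graph n) (c : Fin n → Bool)
                 (proper : ∀ u v → adj G u v ≡ true → c u ≢ c v) where
  open Walks G

  colour-walk : ∀ {u v k} → Walk G u v k → c v ≡ c u xor odd k
  colour-walk {u} here = sym (xor-identityʳ (c u))
  colour-walk {u} {v} (step {v = x} {k = k} e p) = begin
    c v                    ≡⟨ colour-walk p ⟩
    c x xor odd k          ≡⟨ cong (_xor odd k) (¬-not (≢-sym (proper u x e))) ⟩
    not (c u) xor odd k    ≡⟨ sym (not-distribˡ-xor (c u) (odd k)) ⟩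
    not (c u xor odd k)    ≡⟨ not-distribʳ-xor (c u) (odd k) ⟩
    c u xor odd (suc k)    ∎
    where open ≡-Reasoning

  equidistant⇒sameColour : ∀ {w u v k} → Walk G w u k → Walk G w v k → c u ≡ c v
  equidistant⇒sameColour p q = trans (colour-walk p) (sym (colour-walk q))

  sameColour⇒equidistant : ∀ {u v k} → Walk G u v k → c u ≡ c v →
                           Σ (Fin n) λ w → ∃ λ j → Dist G w u j × Dist G w v j
  sameColour⇒equidistant {u} p cu≡cv with shortest p
  ... | d , δ@(q , _) with even⇒double d (x≡x-xor-y⇒y≡false (c u) (odd d) (trans cu≡cv (colour-walk q)))
  ... | j , refl with Dist-split j δ
  ... | w , δuw , δwv = w , j , Dist-sym δuw , δwv

  EBAdj⇔differentColours : Connected G → ∀ {u v} → u ≢ v → EBAdj G u v ⇔ (c u ≢ c v)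
  EBAdj⇔differentColours conn {u} {v} u≢v = mk⇔
    (λ { (_ , noEquidistant) cu≡cv → noEquidistant (sameColour⇒equidistant (proj₂ (conn u v)) cu≡cv) })
    (λ cu≢cv → u≢v , λ { (w , k , (p , _) , (q , _)) → cu≢cv (equidistant⇒sameColour p q) })

  bothColours : ∀ {u x} → adj G u x ≡ true → (Σ (Fin n) λ a → c a ≡ true) × (Σ (Fin n) λ b → c b ≡ false)
  bothColours {u} {x} e with c u in cu | ¬-not (≢-sym (proper u x e))
  ... | true  | cx = (u , cu) , (x , cx)
  ... | false | cx = (x , cx) , (u , cu)

connected⇒edge : ∀ {n} {G : Graph n} → Connected G → 2 ≤ n → Σ (Fin n) λ u → Σ (Fin n) λ x → adj G u x ≡ true
connected⇒edge conn (s≤s (s≤s z≤n)) with conn fzero (fsuc fzero)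
... | _ , step e _ = _ , _ , e

lemma25 : (n : ℕ) (G : Graph n) → Connected G → Bipartite G → IsCompleteBipartite (EBAdj G)
lemma25 n G conn (c , proper) =
  c , (λ u v u≢v → let open Equivalence (EBAdj⇔differentColours conn u≢v) in to , from)
    , λ 2≤n → let (_ , _ , e) = connected⇒edge conn 2≤n in bothColours e
  where open Colouring G c proper
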